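{- Let $G$ be a non-empty graph. Then $G$ does not contain $C_4$ as a topological minor if and only if $G$ satisfies the $C_4$-condition.
   Context: For a graph $G$, let $n(G)=|V(G)|$, $m(G)=|E(G)|$, $\mathsf{c}_3(G)$ the number of triangles ($C_3$ subgraphs) of $G$, and $\mathsf{cc}(G)$ the number of connected components. The diamond is $K_4$ minus one edge. $G$ satisfies the $C_4$-condition if $G$ does not contain the diamond as a subgraph and $n(G)-m(G)+\mathsf{c}_3(G)=\mathsf{cc}(G)$. $C_4$ is the cycle on $4$ vertices. -}

module Defs where

open import Data.Nat using (ℕ; zero; suc; _<_)
open import Data.Nat.Properties using (_<?_)
open import Data.Bool using (Bool; true; false; T; _∧_; _∨_; not; if_then_else_)
open import Data.Fin using (Fin; zero; suc; toℕ)
open import Data.Fin.Properties using (_≟_)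
open import Data.List using (List; []; _∷_; map; concatMap; allFin)
open import Data.Nat.ListAction using (sum)
open import Data.Bool.ListAction using (any; all)
open import Data.List.Membership.Propositional using (_∈_)
open import Data.List.Relation.Unary.Unique.Propositional using (Unique)
open import Data.Product using (Σ; _×_; _,_)
open import Data.Integer using (ℤ; +_; _-_; _+_)
open import Relation.Binary.PropositionalEquality using (_≡_)
open import Relation.Nullary using (¬_; does)
open import Function.Definitions using (Injective)

record Graph (n : ℕ) : Set where
  field
    adj    : Fin n → Fin n → Bool
    sym    : ∀ i j → adj i j ≡ adj j i
    irrefl : ∀ i → adj i i ≡ false
open Graph public

Edge : ∀ {n} → Graph n → Fin n → Fin n → Set
Edge G i j = T (adj G i j)

_<ᵇ_ : ∀ {n} → Fin n → Fin n → Bool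
i <ᵇ j = does (toℕ i <? toℕ j)

nV : ∀ {n} → Graph n → ℕ
nV {n} _ = n

mE : ∀ {n} → Graph n → ℕ
mE {n} G = sum (map (λ p → if edgeB p then 1 else 0)
                 (concatMap (λ i → map (λ j → (i , j)) (allFin n)) (allFin n)))
  where
  edgeB : Fin n × Fin n → Bool
  edgeB (i , j) = (i <ᵇ j) ∧ adj G i j

c3 : ∀ {n} → Graph n → ℕ
c3 {n} G = sum (concatMap (λ i → concatMap (λ j → map (λ k → tri i j k) (allFin n)) (allFin n)) (allFin n))
  where
  tri : Fin n → Fin n → Fin n → ℕ
  tri i j k = if (i <ᵇ j) ∧ (j <ᵇ k) ∧ adj G i j ∧ adj G j k ∧ adj G i k then 1 else 0

reachW : ∀ {n} → Graph n → ℕ → Fin n → Fin n → Bool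
reachW G zero    u v = does (u ≟ v)
reachW {n} G (suc k) u v = reachW G k u v ∨ any (λ w → adj G u w ∧ reachW G k w v) (allFin n)

-- u and v lie in the same connected component (a walk exists; in a graph
-- on n vertices a walk exists iff one of length ≤ n exists)
connectedB : ∀ {n} → Graph n → Fin n → Fin n → Bool
connectedB {n} G u v = reachW G n u v

-- cc(G): number of components, counted by their least vertex
cc : ∀ {n} → Graph n → ℕ
cc {n} G = sum (map (λ v → if isRep v then 1 else 0) (allFin n))
  where
  isRep : Fin n → Bool
  isRep v = all (λ u → not ((u <ᵇ v) ∧ connectedB G u v)) (allFin n)

SubgraphOf : ∀ {k n} → Graph k → Graph n → Set
SubgraphOf {k} {n} H G =
  Σ (Fin k → Fin n) λ f → Injective _≡_ _≡_ f × (∀ i j → Edge H i j → Edge G (f i) (f j))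

-- C₄ : 0 - 1 - 2 - 3 - 0
C4adj : Fin 4 → Fin 4 → Bool
C4adj zero (suc zero) = true
C4adj (suc zero) zero = true
C4adj (suc zero) (suc (suc zero)) = true
C4adj (suc (suc zero)) (suc zero) = true
C4adj (suc (suc zero)) (suc (suc (suc zero))) = true
C4adj (suc (suc (suc zero))) (suc (suc zero)) = true
C4adj (suc (suc (suc zero))) zero = true
C4adj zero (suc (suc (suc zero))) = true
C4adj _ _ = false

C4 : Graph 4
C4 = record { adj = C4adj ; sym = s ; irrefl = r }
  where
  s : ∀ i j → C4adj i j ≡ C4adj j i
  s zero zero = _≡_.refl
  s zero (suc zero) = _≡_.refl
  s zero (suc (suc zero)) = _≡_.refl
  s zero (suc (suc (suc zero))) = _≡_.refl
  s (suc zero) zero = _≡_.refl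
  s (suc zero) (suc zero) = _≡_.refl
  s (suc zero) (suc (suc zero)) = _≡_.refl
  s (suc zero) (suc (suc (suc zero))) = _≡_.refl
  s (suc (suc zero)) zero = _≡_.refl
  s (suc (suc zero)) (suc zero) = _≡_.refl
  s (suc (suc zero)) (suc (suc zero)) = _≡_.refl
  s (suc (suc zero)) (suc (suc (suc zero))) = _≡_.refl
  s (suc (suc (suc zero))) zero = _≡_.refl
  s (suc (suc (suc zero))) (suc zero) = _≡_.refl
  s (suc (suc (suc zero))) (suc (suc zero)) = _≡_.refl
  s (suc (suc (suc zero))) (suc (suc (suc zero))) = _≡_.refl
  r : ∀ i → C4adj i i ≡ false
  r zero = _≡_.refl
  r (suc zero) = _≡_.refl
  r (suc (suc zero)) = _≡_.refl
  r (suc (suc (suc zero))) = _≡_.refl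

-- Diamond = K₄ minus the edge {2,3}
Dadj : Fin 4 → Fin 4 → Bool
Dadj i j = not (does (i ≟ j)) ∧ not (isPair23 i j)
  where
  isPair23 : Fin 4 → Fin 4 → Bool
  isPair23 (suc (suc zero)) (suc (suc (suc zero))) = true
  isPair23 (suc (suc (suc zero))) (suc (suc zero)) = true
  isPair23 _ _ = false

Diamond : Graph 4
Diamond = record { adj = Dadj ; sym = s ; irrefl = r }
  where
  s : ∀ i j → Dadj i j ≡ Dadj j i
  s zero zero = _≡_.refl
  s zero (suc zero) = _≡_.refl
  s zero (suc (suc zero)) = _≡_.refl
  s zero (suc (suc (suc zero))) = _≡_.refl
  s (suc zero) zero = _≡_.refl
  s (suc zero) (suc zero) = _≡_.refl
  s (suc zero) (suc (suc zero)) = _≡_.refl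
  s (suc zero) (suc (suc (suc zero))) = _≡_.refl
  s (suc (suc zero)) zero = _≡_.refl
  s (suc (suc zero)) (suc zero) = _≡_.refl
  s (suc (suc zero)) (suc (suc zero)) = _≡_.refl
  s (suc (suc zero)) (suc (suc (suc zero))) = _≡_.refl
  s (suc (suc (suc zero))) zero = _≡_.refl
  s (suc (suc (suc zero))) (suc zero) = _≡_.refl
  s (suc (suc (suc zero))) (suc (suc zero)) = _≡_.refl
  s (suc (suc (suc zero))) (suc (suc (suc zero))) = _≡_.refl
  r : ∀ i → Dadj i i ≡ false
  r zero = _≡_.refl
  r (suc zero) = _≡_.refl
  r (suc (suc zero)) = _≡_.refl
  r (suc (suc (suc zero))) = _≡_.refl

-- H is a topological minor of G if G contains a subdivision of H:
-- injective branch map φ : V(H) → V(G), and for every edge ij of H (i < j)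
-- a path in G from φ i to φ j whose internal vertices (listed in order)
-- are pairwise distinct, are not branch vertices, and are disjoint from the
-- internal vertices of the paths of all other edges.

PathVia : ∀ {n} → Graph n → Fin n → List (Fin n) → Fin n → Set
PathVia G u []       v = Edge G u v
PathVia G u (x ∷ xs) v = Edge G u x × PathVia G x xs v

record TopologicalMinor {k n : ℕ} (H : Graph k) (G : Graph n) : Set where
  field
    branch      : Fin k → Fin n
    branch-inj  : Injective _≡_ _≡_ branch
    inner       : (i j : Fin k) → toℕ i < toℕ j → Edge H i j → List (Fin n)
    inner-path  : ∀ i j (i<j : toℕ i < toℕ j) (e : Edge H i j) →
                  PathVia G (branch i) (inner i j i<j e) (branch j)
    inner-uniq  : ∀ i j (i<j : toℕ i < toℕ j) (e : Edge H i j) →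
                  Unique (inner i j i<j e)
    inner-nobr  : ∀ i j (i<j : toℕ i < toℕ j) (e : Edge H i j) x →
                  x ∈ inner i j i<j e → ∀ l → ¬ (x ≡ branch l)
    inner-disj  : ∀ i j (i<j : toℕ i < toℕ j) (e : Edge H i j)
                    i' j' (i'<j' : toℕ i' < toℕ j') (e' : Edge H i' j') x →
                  x ∈ inner i j i<j e → x ∈ inner i' j' i'<j' e' →
                  (i ≡ i') × (j ≡ j')

C4Condition : ∀ {n} → Graph n → Set
C4Condition G =
  ¬ SubgraphOf Diamond G ×
  ((+ nV G) - (+ mE G) + (+ c3 G) ≡ + cc G)

-- Induction on n, deleting the vertex 0; write G⁻ = G − 0 and N for the neighbours of 0. Then m
-- and c₃ drop by |N| and by the number of triangles through 0, while cc(G) + k = cc(G⁻) + 1 where k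
-- counts the components of G⁻ meeting N, i.e. the leftmost neighbours (least in N ∩ their
-- component). Charge each u ∈ N with [u leftmost] plus the number of triangles 0 j u with j < u. In a
-- diamond-free graph the edge 0u lies in at most one triangle, and a leftmost u is adjacent to no
-- smaller neighbour, so each charge is at most 1; hence n + c₃ ≤ m + cc. Equality holds iff it holds
-- for G⁻ and every charge is 1. A long cycle (length ≥ 4) breaks this: if it avoids 0 it lives in G⁻;
-- otherwise it leaves a path in G⁻ between two neighbours a, b of 0, and when all charges are 1 any
-- two neighbours of 0 in one component are adjacent, so the edge ab yields a diamond or a long cycle
-- in G⁻. Conversely, without long cycles a neighbour u that is not leftmost reaches a smaller
-- neighbour by a path in G⁻, which must be a single edge. Finally, long cycles are exactly the
-- subdivisions of C₄, and a diamond contains a 4-cycle.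

module Submission where

open import Defs
open import Data.Nat using (ℕ; zero; suc; _+_; _≤_; _<_; z≤n; s≤s)
import Data.Nat.Properties as ℕ
open import Data.Nat.ListAction using (sum)
open import Data.Nat.ListAction.Properties using (sum-++)
open import Data.Nat.Solver using (module +-*-Solver)
import Data.Integer as ℤ
import Data.Integer.Properties as ℤ
open import Data.Integer.Tactic.RingSolver using (solve-∀)
open import Data.Bool using (Bool; true; false; T; _∧_; not; if_then_else_)
open import Data.Bool.Properties using (T-∧; T-∨; T-≡)
open import Data.Bool.ListAction using (all)
open import Data.Fin.Base as Fin using (Fin; zero; suc)
import Data.Fin.Properties as Finₚ
open Finₚ using (_≟_)
open import Data.Fin.Patterns using (0F; 1F; 2F; 3F)
open import Data.List
  using (List; []; _∷_; _++_; [_]; map; concatMap; concat; reverse; length; lookup; tabulate; allFin;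
         initLast; _∷ʳ′_)
open import Data.List.Properties
  using (map-tabulate; map-concatMap; map-∘; map-++; length-map; length-++; length-++-≤ˡ;
         length-++-sucʳ; length-++-comm; ++-assoc; ++-identityʳ; unfold-reverse)
open import Data.List.Membership.Propositional using (_∈_; _∉_)
open import Data.List.Membership.Propositional.Properties
  using (∈-lookup; ∈-allFin; ∈-∃++; ∈-++⁻; ∈-++⁺ˡ; ∈-++⁺ʳ)
import Data.List.Membership.DecPropositional as DecMembership
open import Data.List.Relation.Unary.Any as Any using (here; there; satisfied)
open import Data.List.Relation.Unary.Any.Properties using (any⁺; any⁻; reverse⁻)
import Data.List.Relation.Unary.All as All
open import Data.List.Relation.Unary.All using ([]; _∷_)
open import Data.List.Relation.Unary.All.Properties using (++⁻ˡ; ++⁻ʳ; all⁺; all⁻; ¬Any⇒All¬; All¬⇒¬Any)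
open import Data.List.Relation.Unary.AllPairs using ([]; _∷_)
open import Data.List.Relation.Unary.Unique.Propositional using (Unique)
open import Data.List.Relation.Unary.Unique.Propositional.Properties
  using (++⁺; concat⁺; map⁺; map⁻; Unique[x∷xs]⇒x∉xs)
open import Data.List.Relation.Binary.Disjoint.Propositional using (Disjoint)
open import Data.Product using (Σ; ∃; _×_; _,_; proj₁; proj₂)
open import Data.Sum using (_⊎_; inj₁; inj₂; [_,_]′)
import Data.Sum as Sum
open import Data.Empty using (⊥-elim)
open import Function using (_∘_; id)
open import Function.Bundles using (_⇔_; mk⇔; Equivalence)
open import Function.Definitions using (Injective)
open import Relation.Binary.Construct.Closure.ReflexiveTransitive using (Star; ε; _◅_; _◅◅_; gmap)
  renaming (reverse to Star-reverse)
open import Relation.Binary.Definitions using (tri<; tri≈; tri>)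
import Relation.Binary.PropositionalEquality as ≡
open ≡ using (_≡_; _≢_; _≗_; refl; trans; cong; cong₂; subst)
open import Relation.Nullary using (¬_; ¬?; yes; no; contradiction)
open import Relation.Nullary.Decidable using (T?; decidable-stable)
open import Algebra.Properties.CommutativeMonoid.Sum ℕ.+-0-commutativeMonoid
  using (sum-syntax; ∑-distrib-+; ∑-comm; sum-cong-≗; sum-replicate-zero)
  renaming (sum to ∑)

open Equivalence using (to; from)

-- Counting over Fin n

𝟙 : Bool → ℕ
𝟙 b = if b then 1 else 0

count : ∀ {n} → (Fin n → Bool) → ℕ
count {n} p = ∑[ i < n ] 𝟙 (p i)

sum-tabulate : ∀ {n} (f : Fin n → ℕ) → sum (tabulate f) ≡ ∑ f
sum-tabulate {zero}  f = refl
sum-tabulate {suc n} f = cong (f zero +_) (sum-tabulate (λ i → f (suc i)))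

sum-map-allFin : ∀ n (f : Fin n → ℕ) → sum (map f (allFin n)) ≡ ∑ f
sum-map-allFin n f = trans (cong sum (map-tabulate (λ i → i) f)) (sum-tabulate f)

sum-concatMap : ∀ {A : Set} (f : A → List ℕ) xs →
                sum (concatMap f xs) ≡ sum (map (λ x → sum (f x)) xs)
sum-concatMap f []       = refl
sum-concatMap f (x ∷ xs) = trans (sum-++ (f x) _) (cong (sum (f x) +_) (sum-concatMap f xs))

+-≤-≡⇒≡ : ∀ {a b c d} → a ≤ b → c ≤ d → a + c ≡ b + d → a ≡ b × c ≡ d
+-≤-≡⇒≡ {a} {b} {c} {d} a≤b c≤d eq =
  ℕ.≤-antisym a≤b (ℕ.+-cancelʳ-≤ d b a (ℕ.≤-trans (ℕ.≤-reflexive (≡.sym eq)) (ℕ.+-monoʳ-≤ a c≤d))) ,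
  ℕ.≤-antisym c≤d (ℕ.+-cancelˡ-≤ b d c (ℕ.≤-trans (ℕ.≤-reflexive (≡.sym eq)) (ℕ.+-monoˡ-≤ c a≤b)))

∑-mono-≤ : ∀ {n} {f g : Fin n → ℕ} → (∀ i → f i ≤ g i) → ∑ f ≤ ∑ g
∑-mono-≤ {zero}  f≤g = z≤n
∑-mono-≤ {suc n} f≤g = ℕ.+-mono-≤ (f≤g zero) (∑-mono-≤ (λ i → f≤g (suc i)))

∑-mono-≤-≡⇒≗ : ∀ {n} {f g : Fin n → ℕ} → (∀ i → f i ≤ g i) → ∑ f ≡ ∑ g → f ≗ g
∑-mono-≤-≡⇒≗ {suc n} f≤g eq zero    = proj₁ (+-≤-≡⇒≡ (f≤g zero) (∑-mono-≤ (f≤g ∘ suc)) eq)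
∑-mono-≤-≡⇒≗ {suc n} f≤g eq (suc i) =
  ∑-mono-≤-≡⇒≗ (f≤g ∘ suc) (proj₂ (+-≤-≡⇒≡ (f≤g zero) (∑-mono-≤ (f≤g ∘ suc)) eq)) i

count-witness : ∀ {n} (p : Fin n → Bool) → 0 < count p → ∃ λ i → T (p i)
count-witness {suc n} p pos with p zero in eq
... | true  = zero , subst T (≡.sym eq) _
... | false = let i , t = count-witness (p ∘ suc) pos in suc i , t

count-pos : ∀ {n} (p : Fin n → Bool) {i} → T (p i) → 0 < count p
count-pos p {zero} t with p zero
... | true = s≤s z≤n
count-pos p {suc i} t = ℕ.≤-trans (count-pos (p ∘ suc) t) (ℕ.m≤n+m _ (𝟙 (p zero)))

count≡0 : ∀ {n} (p : Fin n → Bool) → (∀ i → ¬ T (p i)) → count p ≡ 0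
count≡0 p none = ℕ.n≤0⇒n≡0 (ℕ.≮⇒≥ λ pos → let i , t = count-witness p pos in none i t)

count≤1 : ∀ {n} (p : Fin n → Bool) → (∀ i j → T (p i) → T (p j) → i ≡ j) → count p ≤ 1
count≤1 {zero}  p uniq = z≤n
count≤1 {suc n} p uniq with p zero in eq
... | true  = ℕ.≤-reflexive (cong suc (count≡0 (p ∘ suc) λ i t → 0≢suc (uniq zero (suc i) p₀ t)))
  where
  p₀ = subst T (≡.sym eq) _
  0≢suc : ∀ {i : Fin n} → zero ≢ suc i
  0≢suc ()
... | false = count≤1 (p ∘ suc) λ i j ti tj → Finₚ.suc-injective (uniq (suc i) (suc j) ti tj)

count≡1 : ∀ {n} (p : Fin n → Bool) {w} → T (p w) → (∀ i → T (p i) → i ≡ w) → count p ≡ 1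
count≡1 p t only =
  ℕ.≤-antisym (count≤1 p λ i j ti tj → trans (only i ti) (≡.sym (only j tj))) (count-pos p t)

count-split : ∀ {n} (p q : Fin n → Bool) →
              count p ≡ count (λ i → p i ∧ q i) + count (λ i → p i ∧ not (q i))
count-split p q =
  trans (sum-cong-≗ λ i → 𝟙-split (p i) (q i)) (∑-distrib-+ (λ i → 𝟙 (p i ∧ q i)) (λ i → 𝟙 (p i ∧ not (q i))))
  where
  𝟙-split : ∀ a b → 𝟙 a ≡ 𝟙 (a ∧ b) + 𝟙 (a ∧ not b)
  𝟙-split true  true  = refl
  𝟙-split true  false = refl
  𝟙-split false b     = refl

𝟙≡count-∧ : ∀ {n} b (q : Fin n → Bool) → (T b → count q ≡ 1) → 𝟙 b ≡ count (λ i → b ∧ q i)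
𝟙≡count-∧     true  q one = ≡.sym (one _)
𝟙≡count-∧ {n} false q _   = ≡.sym (count≡0 {n} (λ _ → false) λ _ ())

𝟙-T : ∀ {b} → T b → 𝟙 b ≡ 1
𝟙-T {true} _ = refl

𝟙-¬T : ∀ {b} → ¬ T b → 𝟙 b ≡ 0
𝟙-¬T {true}  ¬t = ⊥-elim (¬t _)
𝟙-¬T {false} _  = refl

T-injective : ∀ {a b} → T a ⇔ T b → a ≡ b
T-injective {true}  {true}  _   = refl
T-injective {true}  {false} a⇔b = ⊥-elim (to a⇔b _)
T-injective {false} {true}  a⇔b = ⊥-elim (from a⇔b _)
T-injective {false} {false} _   = refl

T-not : ∀ {a} → T (not a) ⇔ (¬ T a)
T-not {true}  = mk⇔ (λ ()) (λ ¬t → ¬t _)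
T-not {false} = mk⇔ (λ _ ()) _

T-all-allFin : ∀ {n} (p : Fin n → Bool) → T (all p (allFin n)) ⇔ (∀ i → T (p i))
T-all-allFin {n} p = mk⇔ (λ t i → All.lookup (all⁺ p (allFin n) t) (∈-allFin i))
  λ h → all⁻ p {xs = allFin n} (All.tabulate λ {i} _ → h i)

least : ∀ {n} (p : Fin n → Bool) {i} → T (p i) → ∃ λ j → T (p j) × ∀ a → a Fin.< j → ¬ T (p a)
least {suc n} p {i} t with p zero in eq
... | true  = zero , subst T (≡.sym eq) _ , λ _ ()
least {suc n} p {zero}  t | false = ⊥-elim (subst T eq t)
least {suc n} p {suc i} t | false with least (p ∘ suc) t
... | j , tj , below = suc j , tj , λ where
  zero    _         → subst T eq
  (suc a) (s≤s a<j) → below a a<j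

-- Lists without repetition

module _ {A : Set} where

  Unique-++⁻ : ∀ (xs : List A) {ys} → Unique (xs ++ ys) → Unique xs × Unique ys × Disjoint xs ys
  Unique-++⁻ []       u         = [] , u , λ ()
  Unique-++⁻ (x ∷ xs) (x∉ ∷ u) with Unique-++⁻ xs u
  ... | uxs , uys , disj = ++⁻ˡ xs x∉ ∷ uxs , uys , λ where
    (here refl , v∈ys) → All.lookup (++⁻ʳ xs x∉) v∈ys refl
    (there v∈xs , v∈ys) → disj (v∈xs , v∈ys)

  Unique-++-comm : ∀ (xs : List A) {ys} → Unique (xs ++ ys) → Unique (ys ++ xs)
  Unique-++-comm xs u with Unique-++⁻ xs u
  ... | uxs , uys , disj = ++⁺ uys uxs λ (v∈ys , v∈xs) → disj (v∈xs , v∈ys)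

  Unique-dropMiddle : ∀ (xs : List A) {ys zs} → Unique (xs ++ ys ++ zs) → Unique (xs ++ zs)
  Unique-dropMiddle xs {ys} u with Unique-++⁻ xs u
  ... | uxs , uyzs , disj with Unique-++⁻ ys uyzs
  ...   | _ , uzs , _ = ++⁺ uxs uzs λ (v∈xs , v∈zs) → disj (v∈xs , ∈-++⁺ʳ ys v∈zs)

  Unique-reverse : ∀ {xs : List A} → Unique xs → Unique (reverse xs)
  Unique-reverse {[]}     _         = []
  Unique-reverse {x ∷ xs} (x∉ ∷ u) rewrite unfold-reverse x xs =
    ++⁺ (Unique-reverse u) ([] ∷ []) λ where
      (x∈ , here refl) → All.lookup x∉ (reverse⁻ x∈) refl

  lookup-injective : ∀ {xs : List A} → Unique xs → Injective _≡_ _≡_ (lookup xs)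
  lookup-injective (_  ∷ _) {zero}  {zero}  _  = refl
  lookup-injective (x∉ ∷ _) {zero}  {suc j} eq = contradiction eq (All.lookup x∉ (∈-lookup j))
  lookup-injective (x∉ ∷ _) {suc i} {zero}  eq = contradiction (≡.sym eq) (All.lookup x∉ (∈-lookup i))
  lookup-injective (_  ∷ u) {suc i} {suc j} eq = cong suc (lookup-injective u eq)

Unique⇒length≤ : ∀ {n} {xs : List (Fin n)} → Unique xs → length xs ≤ n
Unique⇒length≤ u = Finₚ.injective⇒≤ (lookup-injective u)

length-++-∷ : ∀ {A : Set} (xs : List A) {y ys} → suc (length ys) ≤ length (xs ++ y ∷ ys)
length-++-∷ xs {y} {ys} = ℕ.≤-trans (ℕ.m≤n+m _ (length xs)) (ℕ.≤-reflexive (≡.sym (length-++ xs)))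

Unique-middle-disjoint : ∀ {A : Set} (xs : List A) {ys zs} → Unique (xs ++ ys ++ zs) →
                         Disjoint (xs ++ zs) ys
Unique-middle-disjoint xs {ys} u (v∈xzs , v∈ys) with Unique-++⁻ xs u | ∈-++⁻ xs v∈xzs
... | _ , _ , disj | inj₁ v∈xs = disj (v∈xs , ∈-++⁺ˡ v∈ys)
... | _ , uyzs , _ | inj₂ v∈zs = let _ , _ , disj = Unique-++⁻ ys uyzs in disj (v∈ys , v∈zs)

map-suc⁻ : ∀ {n} (xs : List (Fin (suc n))) → zero ∉ xs → ∃ λ ys → xs ≡ map suc ys
map-suc⁻ []           _   = [] , refl
map-suc⁻ (zero  ∷ xs) 0∉ = ⊥-elim (0∉ (here refl))
map-suc⁻ (suc y ∷ xs) 0∉ with map-suc⁻ xs (0∉ ∘ there)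
... | ys , refl = y ∷ ys , refl

zero∉map-suc : ∀ {n} (xs : List (Fin n)) → Fin.zero ∉ map Fin.suc xs
zero∉map-suc (_ ∷ xs) (there 0∈) = zero∉map-suc xs 0∈

-- Walks and connectivity

module _ {n : ℕ} (G : Graph n) where

  open DecMembership (_≟_ {n}) using (_∈?_)

  Edge-sym : ∀ {i j} → Edge G i j → Edge G j i
  Edge-sym {i} {j} = subst T (Graph.sym G i j)

  Edge-irrefl : ∀ {i} → ¬ Edge G i i
  Edge-irrefl {i} = subst T (irrefl G i)

  Edge⇒≢ : ∀ {i j} → Edge G i j → i ≢ j
  Edge⇒≢ e refl = Edge-irrefl e

  Walk : Fin n → Fin n → Set
  Walk = Star (Edge G)

  Walk-sym : ∀ {u v} → Walk u v → Walk v u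
  Walk-sym = Star-reverse Edge-sym

  PathVia-++⁻ : ∀ {u} ps {v qs w} → PathVia G u (ps ++ v ∷ qs) w → PathVia G u ps v × PathVia G v qs w
  PathVia-++⁻ []       (e , p) = e , p
  PathVia-++⁻ (x ∷ ps) (e , p) = let p₁ , p₂ = PathVia-++⁻ ps p in (e , p₁) , p₂

  PathVia-++⁺ : ∀ {u} ps {v qs w} → PathVia G u ps v → PathVia G v qs w → PathVia G u (ps ++ v ∷ qs) w
  PathVia-++⁺ []       e       q = e , q
  PathVia-++⁺ (x ∷ ps) (e , p) q = e , PathVia-++⁺ ps p q

  PathVia-reverse : ∀ {u} xs {v} → PathVia G u xs v → PathVia G v (reverse xs) u
  PathVia-reverse []       e       = Edge-sym e
  PathVia-reverse (x ∷ xs) (e , p) rewrite unfold-reverse x xs =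
    PathVia-++⁺ (reverse xs) (PathVia-reverse xs p) (Edge-sym e)

  PathVia⇒Walk : ∀ {u} xs {v} → PathVia G u xs v → Walk u v
  PathVia⇒Walk []       e       = e ◅ ε
  PathVia⇒Walk (x ∷ xs) (e , p) = e ◅ PathVia⇒Walk xs p

  SimplePath : Fin n → Fin n → Set
  SimplePath x z = Σ (List (Fin n)) λ mid → PathVia G x mid z × Unique (x ∷ mid ++ [ z ])

  -- Cut the walk at the last visit of its start vertex.
  Walk⇒SimplePath : ∀ {x z} → Walk x z → x ≡ z ⊎ SimplePath x z
  Walk⇒SimplePath ε = inj₁ refl
  Walk⇒SimplePath {x} {z} (_◅_ {j = y} e w) with x ≟ z | Walk⇒SimplePath w
  ... | yes x≡z | _               = inj₁ x≡z
  ... | no x≢z  | inj₁ refl       = inj₂ ([] , e , (x≢z ∷ []) ∷ [] ∷ [])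
  ... | no x≢z  | inj₂ (mid , p , u) with x ∈? y ∷ mid
  ...   | no x∉            = inj₂ (y ∷ mid , (e , p) , ¬Any⇒All¬ _ x∉path ∷ u)
    where
    x∉path : x ∉ y ∷ mid ++ [ z ]
    x∉path x∈ with ∈-++⁻ (y ∷ mid) x∈
    ... | inj₁ x∈ymid    = x∉ x∈ymid
    ... | inj₂ (here x≡z) = x≢z x≡z
  ...   | yes (here refl)  = ⊥-elim (Edge-irrefl e)
  ...   | yes (there x∈mid) with ∈-∃++ x∈mid
  ...     | ps , qs , refl =
    inj₂ (qs , proj₂ (PathVia-++⁻ ps p) ,
          proj₁ (proj₂ (Unique-++⁻ (y ∷ ps) (subst Unique (++-assoc (y ∷ ps) (x ∷ qs) [ z ]) u))))

  reachW-sound : ∀ k {u v} → T (reachW G k u v) → Walk u v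
  reachW-sound zero {u} {v} t with u ≟ v
  ... | yes refl = ε
  reachW-sound (suc k) {u} {v} t with to T-∨ t
  ... | inj₁ t′ = reachW-sound k t′
  ... | inj₂ t′ with satisfied (any⁻ _ (allFin n) t′)
  ...   | w , t″ = let e , r = to T-∧ t″ in e ◅ reachW-sound k r

  reachW-refl : ∀ k v → T (reachW G k v v)
  reachW-refl zero    v with v ≟ v
  ... | yes _  = _
  ... | no v≢v = v≢v refl
  reachW-refl (suc k) v = from T-∨ (inj₁ (reachW-refl k v))

  reachW-step : ∀ k {u w v} → Edge G u w → T (reachW G k w v) → T (reachW G (suc k) u v)
  reachW-step k {w = w} e r =
    from T-∨ (inj₂ (any⁺ _ (Any.map (λ { refl → from T-∧ (e , r) }) (∈-allFin w))))

  reachW-mono : ∀ {k k′} → k ≤ k′ → ∀ {u v} → T (reachW G k u v) → T (reachW G k′ u v)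
  reachW-mono {zero}  {zero}   _        t = t
  reachW-mono {zero}  {suc k′} _        t = from T-∨ (inj₁ (reachW-mono {zero} {k′} z≤n t))
  reachW-mono {suc k} {suc k′} (s≤s le) t with to T-∨ t
  ... | inj₁ t′ = from T-∨ (inj₁ (reachW-mono le t′))
  ... | inj₂ t′ with satisfied (any⁻ _ (allFin n) t′)
  ...   | w , t″ = let e , r = to T-∧ t″ in reachW-step k′ e (reachW-mono le r)

  PathVia⇒reachW : ∀ {u} mid {v} → PathVia G u mid v → T (reachW G (suc (length mid)) u v)
  PathVia⇒reachW []        {v} e   = reachW-step 0 e (reachW-refl 0 v)
  PathVia⇒reachW (x ∷ mid) (e , p) = reachW-step (suc (length mid)) e (PathVia⇒reachW mid p)

  connectedB⇒Walk : ∀ {u v} → T (connectedB G u v) → Walk u v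
  connectedB⇒Walk = reachW-sound n

  -- A simple path has at most n vertices, so the search depth n of connectedB suffices.
  Walk⇒connectedB : ∀ {u v} → Walk u v → T (connectedB G u v)
  Walk⇒connectedB {u} w with Walk⇒SimplePath w
  ... | inj₁ refl               = reachW-mono {k′ = n} z≤n (reachW-refl 0 u)
  ... | inj₂ (mid , p , unique) =
    reachW-mono (ℕ.≤-trans (s≤s (length-++-≤ˡ mid)) (Unique⇒length≤ unique)) (PathVia⇒reachW mid p)

  connectedB-sym : ∀ u v → connectedB G u v ≡ connectedB G v u
  connectedB-sym u v = T-injective (mk⇔ flip′ flip′)
    where
    flip′ : ∀ {x y} → T (connectedB G x y) → T (connectedB G y x)
    flip′ = Walk⇒connectedB ∘ Walk-sym ∘ connectedB⇒Walk

-- Least vertices of components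

module _ {n : ℕ} (G : Graph n) where

  LeastIn : (Fin n → Bool) → Fin n → Set
  LeastIn p v = T (p v) × (∀ u → u Fin.< v → T (p u) → ¬ Walk G u v)

  leastInᵇ : (Fin n → Bool) → Fin n → Bool
  leastInᵇ p v = p v ∧ all (λ u → not ((u <ᵇ v) ∧ p u ∧ connectedB G u v)) (allFin n)

  rootᵇ : Fin n → Bool
  rootᵇ = leastInᵇ (λ _ → true)

  cc≡count-rootᵇ : cc G ≡ count rootᵇ
  cc≡count-rootᵇ = sum-map-allFin n _

  T-leastInᵇ : ∀ p {v} → T (leastInᵇ p v) ⇔ LeastIn p v
  T-leastInᵇ p {v} = mk⇔
    (λ t → let pv , none = to T-∧ t in
      pv , λ u u<v pu w →
        to T-not (to (T-all-allFin _) none u) (from T-∧ (ℕ.<⇒<ᵇ u<v , from T-∧ (pu , Walk⇒connectedB G w))))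
    (λ (pv , below) → from T-∧ (pv , from (T-all-allFin _) λ u → from T-not λ t →
      let u<v , r = to T-∧ t ; pu , c = to T-∧ r in
      below u (ℕ.<ᵇ⇒< _ _ u<v) pu (connectedB⇒Walk G c)))

  LeastIn-unique : ∀ {p v w} → LeastIn p v → LeastIn p w → Walk G v w → v ≡ w
  LeastIn-unique {v = v} {w} (pv , below-v) (pw , below-w) v⇝w with Finₚ.<-cmp v w
  ... | tri< v<w _ _ = ⊥-elim (below-w v v<w pv v⇝w)
  ... | tri≈ _ v≡w _ = v≡w
  ... | tri> _ _ w<v = ⊥-elim (below-v w w<v pw (Walk-sym G v⇝w))

  count-LeastIn-connected : ∀ p {a y} → T (p a) → Walk G a y →
                            count (λ x → leastInᵇ p x ∧ connectedB G x y) ≡ 1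
  count-LeastIn-connected p {a} {y} pa a⇝y
    with least (λ x → p x ∧ connectedB G x y) (from T-∧ (pa , Walk⇒connectedB G a⇝y))
  ... | j , tj , below = count≡1 _ (from T-∧ (from (T-leastInᵇ p) least-j , cj)) unique
    where
    cj = proj₂ (to T-∧ tj)
    least-j : LeastIn p j
    least-j = proj₁ (to T-∧ tj) , λ u u<j pu u⇝j →
      below u u<j (from T-∧ (pu , Walk⇒connectedB G (u⇝j ◅◅ connectedB⇒Walk G cj)))
    unique : ∀ x → T (leastInᵇ p x ∧ connectedB G x y) → x ≡ j
    unique x t = let lx , cx = to T-∧ t in
      LeastIn-unique (to (T-leastInᵇ p) lx) least-j
        (connectedB⇒Walk G cx ◅◅ Walk-sym G (connectedB⇒Walk G cj))

  ¬T-leastInᵇ : ∀ p {v} → T (p v) → ¬ T (leastInᵇ p v) → ∃ λ u → u Fin.< v × T (p u) × Walk G u v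
  ¬T-leastInᵇ p {v} pv ¬least with Finₚ.¬∀⟶∃¬ n (λ u → ¬ T (q u)) (λ u → ¬? (T? (q u))) none-fails
    where
    q : Fin n → Bool
    q u = (u <ᵇ v) ∧ p u ∧ connectedB G u v
    none-fails : ¬ (∀ u → ¬ T (q u))
    none-fails none = ¬least (from T-∧ (pv , from (T-all-allFin _) λ u → from T-not (none u)))
  ... | u , ¬¬qu = let u<v , r = to T-∧ (decidable-stable (T? _) ¬¬qu) ; pu , c = to T-∧ r in
    u , ℕ.<ᵇ⇒< _ _ u<v , pu , connectedB⇒Walk G c

-- Edges and triangles as sums

module _ {n : ℕ} (G : Graph n) where

  mE≡∑ : mE G ≡ ∑[ i < n ] ∑[ j < n ] 𝟙 ((i <ᵇ j) ∧ adj G i j)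
  mE≡∑ = begin
    mE G                                                  ≡⟨ cong sum (map-concatMap h pairs (allFin n)) ⟩
    sum (concatMap (map h ∘ pairs) (allFin n))            ≡⟨ sum-concatMap (map h ∘ pairs) (allFin n) ⟩
    sum (map (λ i → sum (map h (pairs i))) (allFin n))    ≡⟨ sum-map-allFin n _ ⟩
    ∑[ i < n ] sum (map h (pairs i))                      ≡⟨ sum-cong-≗ row ⟩
    ∑[ i < n ] ∑[ j < n ] 𝟙 ((i <ᵇ j) ∧ adj G i j)        ∎
    where
    open ≡.≡-Reasoning
    pairs : Fin n → List (Fin n × Fin n)
    pairs i = map (i ,_) (allFin n)
    h : Fin n × Fin n → ℕ
    h (i , j) = 𝟙 ((i <ᵇ j) ∧ adj G i j)
    row : ∀ i → sum (map h (pairs i)) ≡ ∑[ j < n ] 𝟙 ((i <ᵇ j) ∧ adj G i j)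
    row i = trans (cong sum (≡.sym (map-∘ (allFin n)))) (sum-map-allFin n _)

  triangleᵇ : Fin n → Fin n → Fin n → Bool
  triangleᵇ i j k = (i <ᵇ j) ∧ (j <ᵇ k) ∧ adj G i j ∧ adj G j k ∧ adj G i k

  c3≡∑ : c3 G ≡ ∑[ i < n ] ∑[ j < n ] count (triangleᵇ i j)
  c3≡∑ = trans (sum-concatMap (λ i → concatMap (λ j → map (tri i j) (allFin n)) (allFin n)) (allFin n))
         (trans (sum-map-allFin n _) (sum-cong-≗ λ i →
           trans (sum-concatMap (λ j → map (tri i j) (allFin n)) (allFin n))
           (trans (sum-map-allFin n _) (sum-cong-≗ λ j → sum-map-allFin n (tri i j)))))
    where
    tri : Fin n → Fin n → Fin n → ℕ
    tri i j k = 𝟙 (triangleᵇ i j k)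

-- Long cycles, diamonds and subdivisions of C₄

record LongCycle {n : ℕ} (G : Graph n) : Set where
  constructor cycle
  field
    start  : Fin n
    rest   : List (Fin n)
    closed : PathVia G start rest start
    simple : Unique (start ∷ rest)
    long   : 3 ≤ length rest

DiamondFree : ∀ {n} → Graph n → Set
DiamondFree G = ¬ SubgraphOf Diamond G

module _ {N : ℕ} (G : Graph N) where

  diamond : ∀ {h₁ h₂ o₁ o₂} → Edge G h₁ h₂ → Edge G h₁ o₁ → Edge G h₁ o₂ →
            Edge G h₂ o₁ → Edge G h₂ o₂ → o₁ ≢ o₂ → SubgraphOf Diamond G
  diamond {h₁} {h₂} {o₁} {o₂} e₁₂ e₁₃ e₁₄ e₂₃ e₂₄ o₁≢o₂ =
    lookup corners , lookup-injective unique , edges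
    where
    corners = h₁ ∷ h₂ ∷ o₁ ∷ o₂ ∷ []
    unique : Unique corners
    unique = (Edge⇒≢ G e₁₂ ∷ Edge⇒≢ G e₁₃ ∷ Edge⇒≢ G e₁₄ ∷ [])
           ∷ (Edge⇒≢ G e₂₃ ∷ Edge⇒≢ G e₂₄ ∷ []) ∷ (o₁≢o₂ ∷ []) ∷ [] ∷ []
    edges : ∀ i j → Edge Diamond i j → Edge G (lookup corners i) (lookup corners j)
    edges 0F 1F _ = e₁₂
    edges 0F 2F _ = e₁₃
    edges 0F 3F _ = e₁₄
    edges 1F 0F _ = Edge-sym G e₁₂
    edges 1F 2F _ = e₂₃
    edges 1F 3F _ = e₂₄
    edges 2F 0F _ = Edge-sym G e₁₃
    edges 2F 1F _ = Edge-sym G e₂₃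
    edges 3F 0F _ = Edge-sym G e₁₄
    edges 3F 1F _ = Edge-sym G e₂₄
    edges 0F 0F ()
    edges 1F 1F ()
    edges 2F 2F ()
    edges 2F 3F ()
    edges 3F 2F ()
    edges 3F 3F ()

  common-neighbour-unique : DiamondFree G → ∀ {x y a b} → Edge G x y →
                            Edge G x a → Edge G y a → Edge G x b → Edge G y b → a ≡ b
  common-neighbour-unique df {a = a} {b} exy exa eya exb eyb with a ≟ b
  ... | yes a≡b = a≡b
  ... | no a≢b  = ⊥-elim (df (diamond exy exa exb eya eyb a≢b))

  -- The 4-cycle 0 2 1 3 of the diamond.
  Diamond⇒LongCycle : SubgraphOf Diamond G → LongCycle G
  Diamond⇒LongCycle (f , f-inj , edges) =
    cycle (f 0F) (f 2F ∷ f 1F ∷ f 3F ∷ [])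
      (edges 0F 2F _ , edges 2F 1F _ , edges 1F 3F _ , edges 3F 0F _)
      (map⁺ f-inj (((λ ()) ∷ (λ ()) ∷ (λ ()) ∷ []) ∷ ((λ ()) ∷ (λ ()) ∷ []) ∷ ((λ ()) ∷ []) ∷ [] ∷ []))
      (s≤s (s≤s (s≤s z≤n)))

  module _ {x m₁ m₂ y : Fin N} {mid : List (Fin N)}
           (e₀₁ : Edge G x m₁) (e₁₂ : Edge G m₁ m₂) (p₂₃ : PathVia G m₂ mid y) (e₃₀ : Edge G y x)
           (unique : Unique (x ∷ m₁ ∷ m₂ ∷ mid ++ [ y ])) where

    private
      corners : List (Fin N)
      corners = x ∷ m₁ ∷ m₂ ∷ y ∷ []

      inner : (i j : Fin 4) → i Fin.< j → Edge C4 i j → List (Fin N)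
      inner 2F 3F _ _ = mid
      inner _  _  _ _ = []

      ∈-inner : ∀ i j {i<j e v} → v ∈ inner i j i<j e → v ∈ mid × i ≡ 2F × j ≡ 3F
      ∈-inner 2F 3F v∈ = v∈ , refl , refl
      ∈-inner 0F _  ()
      ∈-inner 1F _  ()
      ∈-inner 3F _  ()
      ∈-inner 2F 0F ()
      ∈-inner 2F 1F ()
      ∈-inner 2F 2F ()

      path : ∀ i j i<j e → PathVia G (lookup corners i) (inner i j i<j e) (lookup corners j)
      path 0F 1F _ _ = e₀₁
      path 1F 2F _ _ = e₁₂
      path 2F 3F _ _ = p₂₃
      path 0F 3F _ _ = Edge-sym G e₃₀
      path 0F 0F _ ()
      path 0F 2F _ ()
      path 1F 0F () _
      path 1F 1F _ ()
      path 1F 3F _ ()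
      path 2F 0F _ ()
      path 2F 1F (s≤s ()) _
      path 2F 2F _ ()
      path 3F 0F () _
      path 3F 1F _ ()
      path 3F 2F (s≤s (s≤s ())) _
      path 3F 3F _ ()

      inner-unique : ∀ i j i<j e → Unique (inner i j i<j e)
      inner-unique 2F 3F _ _ = proj₁ (Unique-++⁻ mid (proj₁ (proj₂ (Unique-++⁻ (x ∷ m₁ ∷ m₂ ∷ []) unique))))
      inner-unique 0F _  _ _ = []
      inner-unique 1F _  _ _ = []
      inner-unique 3F _  _ _ = []
      inner-unique 2F 0F _ _ = []
      inner-unique 2F 1F _ _ = []
      inner-unique 2F 2F _ _ = []

    subdividedC4 : TopologicalMinor C4 G
    subdividedC4 = record
      { branch     = lookup corners
      ; branch-inj = lookup-injective (Unique-dropMiddle (x ∷ m₁ ∷ m₂ ∷ []) unique)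
      ; inner      = inner
      ; inner-path = path
      ; inner-uniq = inner-unique
      ; inner-nobr = λ i j i<j e v v∈ l v≡ →
          Unique-middle-disjoint (x ∷ m₁ ∷ m₂ ∷ []) unique
            (subst (_∈ corners) (≡.sym v≡) (∈-lookup l) , proj₁ (∈-inner i j {i<j} {e} v∈))
      ; inner-disj = λ i j i<j e i′ j′ i′<j′ e′ v v∈ v∈′ →
          let _ , i≡2 , j≡3 = ∈-inner i j {i<j} {e} v∈ ; _ , i′≡2 , j′≡3 = ∈-inner i′ j′ {i′<j′} {e′} v∈′ in
          ≡.trans i≡2 (≡.sym i′≡2) , ≡.trans j≡3 (≡.sym j′≡3)
      }

  LongCycle⇒C4 : LongCycle G → TopologicalMinor C4 G
  LongCycle⇒C4 (cycle _ []       _ _ ())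
  LongCycle⇒C4 (cycle _ (_ ∷ []) _ _ (s≤s ()))
  LongCycle⇒C4 (cycle x (m₁ ∷ m₂ ∷ r) (e₀₁ , e₁₂ , p) u long) with initLast r
  ... | []        = contradiction long λ { (s≤s (s≤s ())) }
  ... | mid ∷ʳ′ y = let p₂₃ , e₃₀ = PathVia-++⁻ G mid p in subdividedC4 e₀₁ e₁₂ p₂₃ e₃₀ u

  module _ (minor : TopologicalMinor C4 G) where

    open TopologicalMinor minor

    private
      I₀₁ = inner 0F 1F (s≤s z≤n) _
      I₁₂ = inner 1F 2F (s≤s (s≤s z≤n)) _
      I₂₃ = inner 2F 3F (s≤s (s≤s (s≤s z≤n))) _
      I₀₃ = inner 0F 3F (s≤s z≤n) _

      -- A segment of the cycle: a branch vertex followed by the interior of an edge path.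
      segment-unique : ∀ {i j i<j e} s {xs} → (∀ {v} → v ∈ xs → v ∈ inner i j i<j e) → Unique xs →
                       Unique (branch s ∷ xs)
      segment-unique s xs⊆ u = ¬Any⇒All¬ _ (λ b∈ → inner-nobr _ _ _ _ _ (xs⊆ b∈) s refl) ∷ u

      segments-disjoint : ∀ {i j i<j e i′ j′ i′<j′ e′} s s′ {xs xs′} →
                          (∀ {v} → v ∈ xs → v ∈ inner i j i<j e) →
                          (∀ {v} → v ∈ xs′ → v ∈ inner i′ j′ i′<j′ e′) →
                          s ≢ s′ → ¬ (i ≡ i′ × j ≡ j′) → Disjoint (branch s ∷ xs) (branch s′ ∷ xs′)
      segments-disjoint s s′ xs⊆ xs′⊆ s≢s′ other-edge = λ where
        (here refl , here eq)  → s≢s′ (branch-inj eq)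
        (here refl , there v∈) → inner-nobr _ _ _ _ _ (xs′⊆ v∈) s refl
        (there v∈ , here refl) → inner-nobr _ _ _ _ _ (xs⊆ v∈) s′ refl
        (there v∈ , there v∈′) → other-edge (inner-disj _ _ _ _ _ _ _ _ _ (xs⊆ v∈) (xs′⊆ v∈′))

      segments : List (List (Fin N))
      segments = (branch 0F ∷ I₀₁) ∷ (branch 1F ∷ I₁₂) ∷ (branch 2F ∷ I₂₃) ∷ (branch 3F ∷ reverse I₀₃) ∷ []

      segments-unique : Unique (concat segments)
      segments-unique = concat⁺
        ( segment-unique 0F id (inner-uniq _ _ _ _)
        ∷ segment-unique 1F id (inner-uniq _ _ _ _)
        ∷ segment-unique 2F id (inner-uniq _ _ _ _)
        ∷ segment-unique 3F reverse⁻ (Unique-reverse (inner-uniq _ _ _ _))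
        ∷ [])
        ( (segments-disjoint 0F 1F id id (λ ()) (λ { (() , _) })
          ∷ segments-disjoint 0F 2F id id (λ ()) (λ { (() , _) })
          ∷ segments-disjoint 0F 3F id reverse⁻ (λ ()) (λ { (_ , ()) }) ∷ [])
        ∷ (segments-disjoint 1F 2F id id (λ ()) (λ { (() , _) })
          ∷ segments-disjoint 1F 3F id reverse⁻ (λ ()) (λ { (() , _) }) ∷ [])
        ∷ (segments-disjoint 2F 3F id reverse⁻ (λ ()) (λ { (() , _) }) ∷ [])
        ∷ [] ∷ [])

    C4⇒LongCycle : LongCycle G
    C4⇒LongCycle = cycle (branch 0F) rest closed
      (subst Unique concat-segments segments-unique) long
      where
      rest = I₀₁ ++ branch 1F ∷ I₁₂ ++ branch 2F ∷ I₂₃ ++ branch 3F ∷ reverse I₀₃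
      closed : PathVia G (branch 0F) rest (branch 0F)
      closed = PathVia-++⁺ G I₀₁ (inner-path _ _ _ _) (PathVia-++⁺ G I₁₂ (inner-path _ _ _ _)
               (PathVia-++⁺ G I₂₃ (inner-path _ _ _ _) (PathVia-reverse G I₀₃ (inner-path _ _ _ _))))
      concat-segments : concat segments ≡ branch 0F ∷ rest
      concat-segments = cong (λ t → branch 0F ∷ I₀₁ ++ branch 1F ∷ I₁₂ ++ branch 2F ∷ I₂₃ ++ t)
                             (++-identityʳ (branch 3F ∷ reverse I₀₃))
      long : 3 ≤ length rest
      long = ℕ.≤-trans (s≤s (ℕ.≤-trans (s≤s (ℕ.≤-trans (s≤s z≤n) (length-++-∷ I₂₃))) (length-++-∷ I₁₂)))
                       (length-++-∷ I₀₁)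

-- Deleting the vertex 0

delete₀ : ∀ {n} → Graph (suc n) → Graph n
delete₀ G = record
  { adj    = λ i j → adj G (suc i) (suc j)
  ; sym    = λ i j → Graph.sym G (suc i) (suc j)
  ; irrefl = irrefl G ∘ suc
  }

module Delete₀ {n : ℕ} (G : Graph (suc n)) where

  G⁻ : Graph n
  G⁻ = delete₀ G

  adj₀ : Fin n → Bool
  adj₀ a = adj G zero (suc a)

  liftWalk : ∀ {u v} → Walk G⁻ u v → Walk G (suc u) (suc v)
  liftWalk = gmap suc id

  ReachedFrom₀ : Fin n → Set
  ReachedFrom₀ v = ∃ λ a → T (adj₀ a) × Walk G⁻ a v

  Walk-from₀ : ∀ {v} → Walk G zero (suc v) → ReachedFrom₀ v
  Walk-fromSuc : ∀ {u v} → Walk G (suc u) (suc v) → Walk G⁻ u v ⊎ ReachedFrom₀ v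

  Walk-from₀ (_◅_ {j = zero}  e _) = ⊥-elim (Edge-irrefl G e)
  Walk-from₀ (_◅_ {j = suc a} e w) = [ (λ w⁻ → a , e , w⁻) , id ]′ (Walk-fromSuc w)

  Walk-fromSuc ε                     = inj₁ ε
  Walk-fromSuc (_◅_ {j = zero}  _ w) = inj₂ (Walk-from₀ w)
  Walk-fromSuc (_◅_ {j = suc _} e w) = Sum.map₁ (e ◅_) (Walk-fromSuc w)

  touchesᵇ : Fin n → Bool
  touchesᵇ v = connectedB G zero (suc v)

  T-touchesᵇ : ∀ {v} → T (touchesᵇ v) ⇔ ReachedFrom₀ v
  T-touchesᵇ = mk⇔ (Walk-from₀ ∘ connectedB⇒Walk G)
                   (λ (a , e , w) → Walk⇒connectedB G (e ◅ liftWalk w))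

  rootᵇ-suc : ∀ v → rootᵇ G (suc v) ≡ rootᵇ G⁻ v ∧ not (touchesᵇ v)
  rootᵇ-suc v = T-injective (mk⇔ fwd bwd)
    where
    fwd : T (rootᵇ G (suc v)) → T (rootᵇ G⁻ v ∧ not (touchesᵇ v))
    fwd t = let _ , below = to (T-leastInᵇ G (λ _ → true)) t in from T-∧
      ( from (T-leastInᵇ G⁻ (λ _ → true)) (_ , λ u u<v _ w → below (suc u) (s≤s u<v) _ (liftWalk w))
      , from T-not λ c → below zero (s≤s z≤n) _ (connectedB⇒Walk G c) )
    bwd : T (rootᵇ G⁻ v ∧ not (touchesᵇ v)) → T (rootᵇ G (suc v))
    bwd t = let r , nt = to T-∧ t ; _ , below = to (T-leastInᵇ G⁻ (λ _ → true)) r in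
      from (T-leastInᵇ G (λ _ → true)) (_ , λ where
        zero    _         _ w → to T-not nt (Walk⇒connectedB G w)
        (suc u) (s≤s u<v) _ w → [ below u u<v _ , to T-not nt ∘ from T-touchesᵇ ]′ (Walk-fromSuc w))

  leftmostᵇ : Fin n → Bool
  leftmostᵇ = leastInᵇ G⁻ adj₀

  private
    touched-roots : ℕ
    touched-roots = count (λ v → rootᵇ G⁻ v ∧ touchesᵇ v)

    cc+touched-roots : cc G + touched-roots ≡ suc (cc G⁻)
    cc+touched-roots = begin
      cc G + touched-roots                         ≡⟨ cong (_+ touched-roots) cc-split ⟩
      suc (count (rootᵇ G ∘ suc) + touched-roots)  ≡⟨ cong (λ c → suc (c + touched-roots))
                                                           (sum-cong-≗ (cong 𝟙 ∘ rootᵇ-suc)) ⟩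
      suc (untouched + touched-roots)              ≡⟨ cong suc (ℕ.+-comm untouched touched-roots) ⟩
      suc (touched-roots + untouched)              ≡⟨ cong suc (count-split (rootᵇ G⁻) touchesᵇ) ⟨
      suc (count (rootᵇ G⁻))                       ≡⟨ cong suc (cc≡count-rootᵇ G⁻) ⟨
      suc (cc G⁻)                                  ∎
      where
      open ≡.≡-Reasoning
      untouched = count (λ v → rootᵇ G⁻ v ∧ not (touchesᵇ v))
      root₀ : rootᵇ G zero ≡ true
      root₀ = to T-≡ (from (T-leastInᵇ G (λ _ → true) {zero}) (_ , λ _ ()))
      cc-split : cc G ≡ suc (count (rootᵇ G ∘ suc))
      cc-split = trans (cc≡count-rootᵇ G) (cong (λ b → 𝟙 b + count (rootᵇ G ∘ suc)) root₀)

    -- Double counting the pairs (u , v) with u leftmost and v the root of the component of u.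
    touched-roots≡leftmost : touched-roots ≡ count leftmostᵇ
    touched-roots≡leftmost = ≡.sym (begin
      count leftmostᵇ                  ≡⟨ sum-cong-≗ (λ u → 𝟙≡count-∧ _ (root-of u) λ _ → one-root u) ⟩
      ∑[ u < n ] ∑[ v < n ] pair u v   ≡⟨ ∑-comm pair ⟩
      ∑[ v < n ] ∑[ u < n ] pair u v   ≡⟨ sum-cong-≗ fibre ⟩
      touched-roots                    ∎)
      where
      open ≡.≡-Reasoning
      root-of : Fin n → Fin n → Bool
      root-of u v = rootᵇ G⁻ v ∧ connectedB G⁻ v u
      one-root : ∀ u → count (root-of u) ≡ 1
      one-root u = count-LeastIn-connected G⁻ _ _ ε
      pair : Fin n → Fin n → ℕ
      pair u v = 𝟙 (leftmostᵇ u ∧ root-of u v)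
      fibre : ∀ v → ∑[ u < n ] pair u v ≡ 𝟙 (rootᵇ G⁻ v ∧ touchesᵇ v)
      fibre v with rootᵇ G⁻ v ∧ touchesᵇ v in eq
      ... | true = let r , t = to T-∧ (subst T (≡.sym eq) _) ; a , e , a⇝v = to T-touchesᵇ t in
        trans (sum-cong-≗ λ u → cong (λ b → 𝟙 (leftmostᵇ u ∧ b))
                                  (trans (cong (_∧ connectedB G⁻ v u) (to T-≡ r)) (connectedB-sym G⁻ v u)))
              (count-LeastIn-connected G⁻ adj₀ e a⇝v)
      ... | false = count≡0 (λ u → leftmostᵇ u ∧ root-of u v) λ u t →
        let l , r = to T-∧ t ; rv , c = to T-∧ r ; au , _ = to (T-leastInᵇ G⁻ adj₀) l in
        subst T eq (from T-∧ (rv , from T-touchesᵇ (u , au , Walk-sym G⁻ (connectedB⇒Walk G⁻ c))))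

  cc-delete₀ : cc G + count leftmostᵇ ≡ suc (cc G⁻)
  cc-delete₀ = subst (λ k → cc G + k ≡ suc (cc G⁻)) touched-roots≡leftmost cc+touched-roots

  deg₀ : ℕ
  deg₀ = count adj₀

  lowerNbrᵇ : Fin n → Fin n → Bool
  lowerNbrᵇ u j = (j <ᵇ u) ∧ adj₀ j ∧ adj G⁻ j u ∧ adj₀ u

  triangles₀ : ℕ
  triangles₀ = ∑[ u < n ] count (lowerNbrᵇ u)

  mE-delete₀ : mE G ≡ deg₀ + mE G⁻
  mE-delete₀ = trans (mE≡∑ G) (cong (deg₀ +_) (≡.sym (mE≡∑ G⁻)))

  c3-delete₀ : c3 G ≡ triangles₀ + c3 G⁻
  c3-delete₀ = trans (c3≡∑ G) (cong₂ _+_ through₀ (trans (sum-cong-≗ avoiding₀) (≡.sym (c3≡∑ G⁻))))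
    where
    through₀ : ∑[ j < suc n ] count (triangleᵇ G zero j) ≡ triangles₀
    through₀ = trans (cong (_+ ∑[ j < n ] count (triangleᵇ G zero (suc j))) (sum-replicate-zero (suc n)))
                     (∑-comm λ j u → 𝟙 (lowerNbrᵇ u j))
    avoiding₀ : ∀ i → ∑[ j < suc n ] count (triangleᵇ G (suc i) j) ≡ ∑[ j < n ] count (triangleᵇ G⁻ i j)
    avoiding₀ i =
      trans (cong (_+ ∑[ j < n ] count (triangleᵇ G (suc i) (suc j))) (sum-replicate-zero (suc n)))
            (sum-cong-≗ λ j → cong (_+ count (triangleᵇ G⁻ i j)) (𝟙-∧-false (i <ᵇ j)))
      where
      𝟙-∧-false : ∀ a → 𝟙 (a ∧ false) ≡ 0
      𝟙-∧-false true  = refl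
      𝟙-∧-false false = refl

  open DecMembership (_≟_ {suc n}) using (_∈?_)

  PathVia-lift : ∀ {a} ms {b} → PathVia G⁻ a ms b → PathVia G (suc a) (map suc ms) (suc b)
  PathVia-lift []       e       = e
  PathVia-lift (m ∷ ms) (e , p) = e , PathVia-lift ms p

  PathVia-lower : ∀ {a} ms {b} → PathVia G (suc a) (map suc ms) (suc b) → PathVia G⁻ a ms b
  PathVia-lower []       e       = e
  PathVia-lower (m ∷ ms) (e , p) = e , PathVia-lower ms p

  DiamondFree-delete₀ : DiamondFree G → DiamondFree G⁻
  DiamondFree-delete₀ df (f , f-inj , edges) = df (suc ∘ f , f-inj ∘ Finₚ.suc-injective , edges)

  LongCycle-lift : LongCycle G⁻ → LongCycle G
  LongCycle-lift (cycle x ms p u l) =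
    cycle (suc x) (map suc ms) (PathVia-lift ms p) (map⁺ Finₚ.suc-injective u)
          (subst (3 ≤_) (≡.sym (length-map suc ms)) l)

  record Bypass : Set where
    constructor bypass
    field
      {a b}    : Fin n
      interior : List (Fin n)
      adj-a    : T (adj₀ a)
      adj-b    : T (adj₀ b)
      path     : PathVia G⁻ a interior b
      simple   : Unique (a ∷ interior ++ [ b ])
      nonempty : 1 ≤ length interior

  Bypass⇒LongCycle : Bypass → LongCycle G
  Bypass⇒LongCycle (bypass []       _  _  _ _ ())
  Bypass⇒LongCycle (bypass {a} {b} (c ∷ ms) ea eb p u _) =
    cycle zero (map suc (a ∷ c ∷ ms ++ [ b ]))
      (ea , subst (λ xs → PathVia G (suc a) xs zero) (≡.sym (map-++ suc (c ∷ ms) [ b ]))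
              (PathVia-++⁺ G (map suc (c ∷ ms)) (PathVia-lift (c ∷ ms) p) (Edge-sym G eb)))
      (¬Any⇒All¬ _ (zero∉map-suc (a ∷ c ∷ ms ++ [ b ])) ∷ map⁺ Finₚ.suc-injective u)
      (s≤s (s≤s (ℕ.≤-trans (length-++-∷ ms) (ℕ.≤-reflexive (≡.sym (length-map suc (ms ++ [ b ])))))))

  private
    bypass-between : ∀ {m y} interior → Edge G zero m → PathVia G m interior y → Edge G y zero →
                     Unique (zero ∷ m ∷ interior ++ [ y ]) → 1 ≤ length interior → Bypass
    bypass-between {zero}          _ e₀ _ _  _ _ = ⊥-elim (Edge-irrefl G e₀)
    bypass-between {suc _} {zero}  _ _  _ e₀ _ _ = ⊥-elim (Edge-irrefl G e₀)
    bypass-between {suc a} {suc b} interior ea p eb (0∉ ∷ u) l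
      with map-suc⁻ interior (λ 0∈ → All¬⇒¬Any 0∉ (there (∈-++⁺ˡ 0∈)))
    ... | ys , refl =
      bypass ys ea (Edge-sym G eb) (PathVia-lower ys p)
        (map⁻ (subst Unique (≡.sym (cong (suc a ∷_) (map-++ suc ys [ b ]))) u))
        (subst (1 ≤_) (length-map suc ys) l)

    through₀ : ∀ {ms} → PathVia G zero ms zero → Unique (zero ∷ ms) → 3 ≤ length ms → Bypass
    through₀ {m ∷ r} (e₀ , p) u long with initLast r
    ... | []             = contradiction long λ { (s≤s ()) }
    ... | []      ∷ʳ′ y  = contradiction long λ { (s≤s (s≤s ())) }
    ... | (c ∷ mid) ∷ʳ′ y = let p′ , e = PathVia-++⁻ G (c ∷ mid) p in
      bypass-between (c ∷ mid) e₀ p′ e u (s≤s z≤n)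

  LongCycle-delete₀ : LongCycle G → LongCycle G⁻ ⊎ Bypass
  LongCycle-delete₀ (cycle x ms p u l) with zero ∈? x ∷ ms
  ... | yes (here refl) = inj₂ (through₀ p u l)
  ... | yes (there 0∈) with ∈-∃++ 0∈
  ...   | ps , qs , refl = let p₁ , p₂ = PathVia-++⁻ G ps p in
    inj₂ (through₀ (PathVia-++⁺ G qs p₂ p₁) (Unique-++-comm (x ∷ ps) u)
                   (subst (3 ≤_) (rotate-length ps qs) l))
    where
    rotate-length : ∀ (ps qs : List (Fin (suc n))) → length (ps ++ zero ∷ qs) ≡ length (qs ++ x ∷ ps)
    rotate-length ps qs = trans (length-++-sucʳ ps zero qs)
                         (trans (cong suc (length-++-comm ps qs)) (≡.sym (length-++-sucʳ qs x ps)))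
  LongCycle-delete₀ (cycle zero    ms p u l) | no 0∉ = ⊥-elim (0∉ (here refl))
  LongCycle-delete₀ (cycle (suc x) ms p u l) | no 0∉ with map-suc⁻ ms (0∉ ∘ there)
  ... | ys , refl = inj₁ (cycle x ys (PathVia-lower ys p) (map⁻ u) (subst (3 ≤_) (length-map suc ys) l))

  Leftmost : Fin n → Set
  Leftmost u = T (leftmostᵇ u)

  Charge : Fin n → ℕ
  Charge u = 𝟙 (leftmostᵇ u) + count (lowerNbrᵇ u)

  T-lowerNbrᵇ : ∀ {u j} → T (lowerNbrᵇ u j) → j Fin.< u × T (adj₀ j) × Edge G⁻ j u × T (adj₀ u)
  T-lowerNbrᵇ {u} {j} t =
    let j<u , r = to T-∧ t ; aj , r′ = to T-∧ r ; e , au = to T-∧ r′ in ℕ.<ᵇ⇒< _ _ j<u , aj , e , au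

  lowerNbr : ∀ {u j} → j Fin.< u → T (adj₀ j) → Edge G⁻ j u → T (adj₀ u) → T (lowerNbrᵇ u j)
  lowerNbr j<u aj e au = from T-∧ (ℕ.<⇒<ᵇ j<u , from T-∧ (aj , from T-∧ (e , au)))

  count-lowerNbr-leftmost : ∀ {u} → Leftmost u → count (lowerNbrᵇ u) ≡ 0
  count-lowerNbr-leftmost {u} lu = count≡0 (lowerNbrᵇ u) λ j t →
    let j<u , aj , e , _ = T-lowerNbrᵇ {u} {j} t in proj₂ (to (T-leastInᵇ G⁻ adj₀) lu) j j<u aj (e ◅ ε)

  count-lowerNbr≤1 : DiamondFree G → ∀ u → count (lowerNbrᵇ u) ≤ 1
  count-lowerNbr≤1 df u = count≤1 (lowerNbrᵇ u) λ i j ti tj →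
    let _ , ai , ei , au = T-lowerNbrᵇ {u} {i} ti ; _ , aj , ej , _ = T-lowerNbrᵇ {u} {j} tj in
    Finₚ.suc-injective (common-neighbour-unique G df au ai (Edge-sym G ei) aj (Edge-sym G ej))

  charge-non-neighbour : ∀ {u} → ¬ T (adj₀ u) → Charge u ≡ 0
  charge-non-neighbour {u} ¬au =
    cong₂ _+_ (𝟙-¬T (¬au ∘ proj₁ ∘ to (T-leastInᵇ G⁻ adj₀ {u})))
              (count≡0 (lowerNbrᵇ u) λ j t → ¬au (proj₂ (proj₂ (proj₂ (T-lowerNbrᵇ {u} {j} t)))))

  charge≤ : DiamondFree G → ∀ u → Charge u ≤ 𝟙 (adj₀ u)
  charge≤ df u with T? (adj₀ u) | T? (leftmostᵇ u)
  ... | no ¬au | _      = ℕ.≤-trans (ℕ.≤-reflexive (charge-non-neighbour ¬au)) z≤n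
  ... | yes au | yes lu =
    ℕ.≤-reflexive (trans (cong₂ _+_ (𝟙-T lu) (count-lowerNbr-leftmost lu)) (≡.sym (𝟙-T au)))
  ... | yes au | no ¬lu = begin
    Charge u                ≡⟨ cong (_+ count (lowerNbrᵇ u)) (𝟙-¬T ¬lu) ⟩
    count (lowerNbrᵇ u)     ≤⟨ count-lowerNbr≤1 df u ⟩
    1                       ≡⟨ 𝟙-T au ⟨
    𝟙 (adj₀ u)              ∎
    where open ℕ.≤-Reasoning

  -- Without long cycles, a neighbour u of 0 that is not leftmost in its component of G⁻ is adjacent
  -- to a smaller neighbour, since otherwise a shortest path to it closes a long cycle through 0.
  charge≥ : ¬ LongCycle G → ∀ u → 𝟙 (adj₀ u) ≤ Charge u
  charge≥ ¬cyc u with T? (adj₀ u) | T? (leftmostᵇ u)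
  ... | no ¬au | _      = ℕ.≤-reflexive (trans (𝟙-¬T ¬au) (≡.sym (charge-non-neighbour ¬au)))
  ... | yes au | yes lu = ℕ.≤-trans (ℕ.≤-reflexive (trans (𝟙-T au) (≡.sym (𝟙-T lu)))) (ℕ.m≤m+n _ _)
  ... | yes au | no ¬lu with ¬T-leastInᵇ G⁻ adj₀ au ¬lu
  ...   | w , w<u , aw , w⇝u with T? (adj G⁻ w u)
  ...     | yes e = begin
    𝟙 (adj₀ u)           ≡⟨ 𝟙-T au ⟩
    1                    ≤⟨ count-pos (lowerNbrᵇ u) (lowerNbr w<u aw e au) ⟩
    count (lowerNbrᵇ u)  ≤⟨ ℕ.m≤n+m _ (𝟙 (leftmostᵇ u)) ⟩
    Charge u             ∎
    where open ℕ.≤-Reasoning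
  ...     | no ¬e with Walk⇒SimplePath G⁻ w⇝u
  ...       | inj₁ refl                   = ⊥-elim (Finₚ.<-irrefl refl w<u)
  ...       | inj₂ ([]        , e , _)    = ⊥-elim (¬e e)
  ...       | inj₂ (c ∷ mid , p , simple) =
    ⊥-elim (¬cyc (Bypass⇒LongCycle (bypass (c ∷ mid) aw au p simple (s≤s z≤n))))

  module _ (df : DiamondFree G) (tight : ∀ u → Charge u ≡ 𝟙 (adj₀ u)) where

    private
      Leftmost⇒LeastIn : ∀ {u} → Leftmost u → LeastIn G⁻ adj₀ u
      Leftmost⇒LeastIn = to (T-leastInᵇ G⁻ adj₀)

      partner : ∀ {u} → T (adj₀ u) → ¬ Leftmost u → ∃ λ p → p Fin.< u × T (adj₀ p) × Edge G⁻ p u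
      partner {u} au ¬lu =
        let p , t = count-witness (lowerNbrᵇ u) (ℕ.≤-reflexive (≡.sym one))
            p<u , ap , e , _ = T-lowerNbrᵇ t
        in p , p<u , ap , e
        where
        one : count (lowerNbrᵇ u) ≡ 1
        one = trans (≡.sym (cong (_+ count (lowerNbrᵇ u)) (𝟙-¬T ¬lu))) (trans (tight u) (𝟙-T au))

      -- The partner is leftmost: otherwise it would have a partner of its own, giving the edge
      -- 0 p two triangles.
      leftmost-partner : ∀ {u} → T (adj₀ u) → ¬ Leftmost u → ∃ λ p → Leftmost p × Edge G⁻ p u
      leftmost-partner au ¬lu with partner au ¬lu
      ... | p , p<u , ap , epu with T? (leftmostᵇ p)
      ...   | yes lp  = p , lp , epu
      ...   | no ¬lp with partner ap ¬lp
      ...     | r , r<p , ar , erp =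
        let u≡r = Finₚ.suc-injective (common-neighbour-unique G df ap au epu ar (Edge-sym G erp)) in
        ⊥-elim (Finₚ.<-irrefl (≡.sym u≡r) (Finₚ.<-trans r<p p<u))

      adjacent-to-non-leftmost : ∀ {a b} → T (adj₀ a) → T (adj₀ b) → a ≢ b → Walk G⁻ a b → ¬ Leftmost b →
                                 Edge G⁻ a b
      adjacent-to-non-leftmost {a} {b} aa ab a≢b a⇝b ¬lb with leftmost-partner ab ¬lb
      ... | p , lp , epb with a ≟ p
      ...   | yes refl = epb
      ...   | no a≢p with T? (leftmostᵇ a)
      ...     | yes la = ⊥-elim (a≢p (LeastIn-unique G⁻ (Leftmost⇒LeastIn la) (Leftmost⇒LeastIn lp)
                                                         (a⇝b ◅◅ Edge-sym G⁻ epb ◅ ε)))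
      ...     | no ¬la with leftmost-partner aa ¬la
      ...       | q , lq , eqa with LeastIn-unique G⁻ (Leftmost⇒LeastIn lq) (Leftmost⇒LeastIn lp)
                                                   (eqa ◅ a⇝b ◅◅ Edge-sym G⁻ epb ◅ ε)
      ...         | refl = ⊥-elim (a≢b (Finₚ.suc-injective
                             (common-neighbour-unique G df (proj₁ (Leftmost⇒LeastIn lp)) aa eqa ab epb)))

    connected-neighbours-adjacent : ∀ {a b} → T (adj₀ a) → T (adj₀ b) → a ≢ b → Walk G⁻ a b → Edge G⁻ a b
    connected-neighbours-adjacent {a} {b} aa ab a≢b a⇝b with T? (leftmostᵇ b) | T? (leftmostᵇ a)
    ... | no ¬lb | _      = adjacent-to-non-leftmost aa ab a≢b a⇝b ¬lb
    ... | yes lb | no ¬la = Edge-sym G⁻ (adjacent-to-non-leftmost ab aa (a≢b ∘ ≡.sym) (Walk-sym G⁻ a⇝b) ¬la)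
    ... | yes lb | yes la = ⊥-elim (a≢b (LeastIn-unique G⁻ (Leftmost⇒LeastIn la) (Leftmost⇒LeastIn lb) a⇝b))

    ¬Bypass : ¬ LongCycle G⁻ → ¬ Bypass
    ¬Bypass ¬cyc⁻ (bypass [] _ _ _ _ ())
    ¬Bypass ¬cyc⁻ (bypass {a} {b} (c ∷ mid) aa ab p u _) with
      connected-neighbours-adjacent aa ab a≢b (PathVia⇒Walk G⁻ (c ∷ mid) p)
      where
      a≢b : a ≢ b
      a≢b refl = Unique[x∷xs]⇒x∉xs u (∈-++⁺ʳ (c ∷ mid) (here refl))
    ¬Bypass ¬cyc⁻ (bypass (c ∷ [])        aa ab (eac , ecb) u _) | eab =
      df (diamond G eab (Edge-sym G aa) eac (Edge-sym G ab) (Edge-sym G ecb) λ ())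
    ¬Bypass ¬cyc⁻ (bypass {a} {b} (c ∷ c′ ∷ mid) aa ab p u _) | eab =
      ¬cyc⁻ (cycle a ((c ∷ c′ ∷ mid) ++ [ b ]) (PathVia-++⁺ G⁻ (c ∷ c′ ∷ mid) p (Edge-sym G⁻ eab)) u
                   (s≤s (s≤s (length-++-∷ mid))))

    ¬LongCycle-delete₀ : ¬ LongCycle G⁻ → ¬ LongCycle G
    ¬LongCycle-delete₀ ¬cyc⁻ c with LongCycle-delete₀ c
    ... | inj₁ c⁻ = ¬cyc⁻ c⁻
    ... | inj₂ b  = ¬Bypass ¬cyc⁻ b

  ∑-Charge : count leftmostᵇ + triangles₀ ≡ ∑[ u < n ] Charge u
  ∑-Charge = ≡.sym (∑-distrib-+ (𝟙 ∘ leftmostᵇ) (count ∘ lowerNbrᵇ))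

  charges≤ : DiamondFree G → count leftmostᵇ + triangles₀ ≤ deg₀
  charges≤ df = ℕ.≤-trans (ℕ.≤-reflexive ∑-Charge) (∑-mono-≤ (charge≤ df))

  -- Both sides of n + c₃ ≤ m + cc, shifted by the number of leftmost neighbours of 0.
  lhs-delete₀ : suc n + c3 G + count leftmostᵇ ≡ suc (n + c3 G⁻ + (count leftmostᵇ + triangles₀))
  lhs-delete₀ = trans (cong (λ t → suc n + t + count leftmostᵇ) c3-delete₀)
                      (solve 4 (λ n t c k → (con 1 :+ n :+ (t :+ c)) :+ k := con 1 :+ (n :+ c :+ (k :+ t)))
                             refl n triangles₀ (c3 G⁻) (count leftmostᵇ))
    where open +-*-Solver

  rhs-delete₀ : mE G + cc G + count leftmostᵇ ≡ suc (mE G⁻ + cc G⁻ + deg₀)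
  rhs-delete₀ = begin
    mE G + cc G + count leftmostᵇ             ≡⟨ ℕ.+-assoc (mE G) (cc G) _ ⟩
    mE G + (cc G + count leftmostᵇ)           ≡⟨ cong₂ _+_ mE-delete₀ cc-delete₀ ⟩
    deg₀ + mE G⁻ + suc (cc G⁻)                ≡⟨ solve 3 (λ d m c → d :+ m :+ (con 1 :+ c)
                                                                := con 1 :+ (m :+ c :+ d))
                                                        refl deg₀ (mE G⁻) (cc G⁻) ⟩
    suc (mE G⁻ + cc G⁻ + deg₀)                ∎
    where
    open ≡.≡-Reasoning
    open +-*-Solver

-- The inequality n + c₃ ≤ m + cc and its equality case

n+c3≤mE+cc : ∀ {n} (G : Graph n) → DiamondFree G → n + c3 G ≤ mE G + cc G
n+c3≤mE+cc {zero}  G df = z≤n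
n+c3≤mE+cc {suc n} G df = ℕ.+-cancelʳ-≤ (count leftmostᵇ) _ _ (begin
  suc n + c3 G + count leftmostᵇ                         ≡⟨ lhs-delete₀ ⟩
  suc (n + c3 G⁻ + (count leftmostᵇ + triangles₀))       ≤⟨ s≤s (ℕ.+-mono-≤ induction (charges≤ df)) ⟩
  suc (mE G⁻ + cc G⁻ + deg₀)                             ≡⟨ rhs-delete₀ ⟨
  mE G + cc G + count leftmostᵇ                          ∎)
  where
  open Delete₀ G
  open ℕ.≤-Reasoning
  induction = n+c3≤mE+cc G⁻ (DiamondFree-delete₀ df)

n+c3≡mE+cc : ∀ {n} (G : Graph n) → DiamondFree G → ¬ LongCycle G → n + c3 G ≡ mE G + cc G
n+c3≡mE+cc {zero}  G df ¬cyc = refl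
n+c3≡mE+cc {suc n} G df ¬cyc = ℕ.+-cancelʳ-≡ (count leftmostᵇ) _ _ (begin
  suc n + c3 G + count leftmostᵇ                         ≡⟨ lhs-delete₀ ⟩
  suc (n + c3 G⁻ + (count leftmostᵇ + triangles₀))       ≡⟨ cong suc (cong₂ _+_ induction charges≡) ⟩
  suc (mE G⁻ + cc G⁻ + deg₀)                             ≡⟨ rhs-delete₀ ⟨
  mE G + cc G + count leftmostᵇ                          ∎)
  where
  open Delete₀ G
  open ≡.≡-Reasoning
  induction = n+c3≡mE+cc G⁻ (DiamondFree-delete₀ df) (¬cyc ∘ LongCycle-lift)
  charges≡ : count leftmostᵇ + triangles₀ ≡ deg₀
  charges≡ = trans ∑-Charge (sum-cong-≗ λ u → ℕ.≤-antisym (charge≤ df u) (charge≥ ¬cyc u))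

n+c3≡mE+cc⇒¬LongCycle : ∀ {n} (G : Graph n) → DiamondFree G → n + c3 G ≡ mE G + cc G → ¬ LongCycle G
n+c3≡mE+cc⇒¬LongCycle {zero}  G df eq (cycle () _ _ _ _)
n+c3≡mE+cc⇒¬LongCycle {suc n} G df eq =
  ¬LongCycle-delete₀ df tight (n+c3≡mE+cc⇒¬LongCycle G⁻ (DiamondFree-delete₀ df) (proj₁ split))
  where
  open Delete₀ G
  split : n + c3 G⁻ ≡ mE G⁻ + cc G⁻ × count leftmostᵇ + triangles₀ ≡ deg₀
  split = +-≤-≡⇒≡ (n+c3≤mE+cc G⁻ (DiamondFree-delete₀ df)) (charges≤ df)
            (ℕ.suc-injective (trans (≡.sym lhs-delete₀) (trans (cong (_+ count leftmostᵇ) eq) rhs-delete₀)))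
  tight : ∀ u → Charge u ≡ 𝟙 (adj₀ u)
  tight = ∑-mono-≤-≡⇒≗ (charge≤ df) (trans (≡.sym ∑-Charge) (proj₂ split))

ℤ-rearrange : ∀ {n m c k} → (ℤ.+ n ℤ.- ℤ.+ m ℤ.+ ℤ.+ c ≡ ℤ.+ k) ⇔ (n + c ≡ m + k)
ℤ-rearrange {n} {m} {c} {k} = mk⇔
  (λ eq → ℤ.+-injective (begin
    ℤ.+ n ℤ.+ ℤ.+ c                      ≡⟨ add-sub-add (ℤ.+ n) (ℤ.+ m) (ℤ.+ c) ⟩
    (ℤ.+ n ℤ.- ℤ.+ m ℤ.+ ℤ.+ c) ℤ.+ ℤ.+ m ≡⟨ cong (ℤ._+ ℤ.+ m) eq ⟩
    ℤ.+ k ℤ.+ ℤ.+ m                      ≡⟨ cong ℤ.+_ (ℕ.+-comm k m) ⟩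
    ℤ.+ m ℤ.+ ℤ.+ k                      ∎))
  (λ eq → begin
    ℤ.+ n ℤ.- ℤ.+ m ℤ.+ ℤ.+ c            ≡⟨ sub-add-comm (ℤ.+ n) (ℤ.+ m) (ℤ.+ c) ⟩
    (ℤ.+ n ℤ.+ ℤ.+ c) ℤ.- ℤ.+ m          ≡⟨ cong (λ t → ℤ.+ t ℤ.- ℤ.+ m) eq ⟩
    (ℤ.+ m ℤ.+ ℤ.+ k) ℤ.- ℤ.+ m          ≡⟨ add-sub-cancel (ℤ.+ m) (ℤ.+ k) ⟩
    ℤ.+ k                                ∎)
  where
  open ≡.≡-Reasoning
  add-sub-add : ∀ (a b c : ℤ.ℤ) → a ℤ.+ c ≡ (a ℤ.- b ℤ.+ c) ℤ.+ b
  add-sub-add = solve-∀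
  sub-add-comm : ∀ (a b c : ℤ.ℤ) → a ℤ.- b ℤ.+ c ≡ (a ℤ.+ c) ℤ.- b
  sub-add-comm = solve-∀
  add-sub-cancel : ∀ (a b : ℤ.ℤ) → (a ℤ.+ b) ℤ.- a ≡ b
  add-sub-cancel = solve-∀

lemma20 : (n : ℕ) → 0 < n → (G : Graph n) →
    (¬ TopologicalMinor C4 G) ⇔ C4Condition G
lemma20 n _ G = mk⇔
  (λ ¬minor → let ¬cycle = ¬minor ∘ LongCycle⇒C4 G in
    ¬cycle ∘ Diamond⇒LongCycle G , from ℤ-rearrange (n+c3≡mE+cc G (¬cycle ∘ Diamond⇒LongCycle G) ¬cycle))
  (λ (df , eq) → n+c3≡mE+cc⇒¬LongCycle G df (to ℤ-rearrange eq) ∘ C4⇒LongCycle G)
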